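{- Let $n\ge 6$ and let $\lambda$ be a partition of $n$ with $\lambda\neq(1^n)$ and $\lambda\neq(n)$. Let $m(\lambda)$ and $M(\lambda)$ denote the minimum and maximum of $\mathrm{maj}(T)$ over all standard Young tableaux $T$ of shape $\lambda$. Then $M(\lambda)-m(\lambda)\ge 4$. Moreover, if $\lambda=(a^b)$ is a rectangle (i.e. $b$ rows each of length $a$), then $M(\lambda)-m(\lambda)\ge 6$.
   Context: A standard Young tableau of shape $\lambda\vdash n$ is a filling of the Young diagram of $\lambda$ by $1,\dots,n$ increasing along rows and down columns. For such $T$, $i\in\{1,\dots,n-1\}$ is a descent if $i+1$ appears in a lower row than $i$, and $\mathrm{maj}(T)$ is the sum of the descents. -}

module Defs where

open import Data.Nat.Base using (ℕ; zero; suc; _+_; _∸_; _<_; _≤_; _≥_; _<ᵇ_; _≡ᵇ_)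
open import Data.Bool.Base using (Bool; true; false; if_then_else_)
open import Data.List.Base using (List; []; _∷_; map; concat; applyUpTo; length)
open import Data.Nat.ListAction using (sum)
open import Data.Bool.ListAction using (any)
open import Data.Maybe.Base using (Maybe; just; nothing)
open import Data.Product.Base using (Σ; _×_; _,_)
open import Data.List.Relation.Binary.Permutation.Propositional using (_↭_)
open import Relation.Binary.PropositionalEquality using (_≡_)

at : {A : Set} → List A → ℕ → Maybe A
at []       _       = nothing
at (x ∷ xs) zero    = just x
at (x ∷ xs) (suc i) = at xs i

record IsPartition (n : ℕ) (λ′ : List ℕ) : Set where
  field
    positive   : ∀ i x → at λ′ i ≡ just x → 1 ≤ x
    decreasing : ∀ i x y → at λ′ i ≡ just x → at λ′ (suc i) ≡ just y → y ≤ x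
    sums       : sum λ′ ≡ n

-- A tableau is given by its list of rows (row 0 is the top row).
-- entry T r c : the entry in row r, column c (if that cell exists).
entry : List (List ℕ) → ℕ → ℕ → Maybe ℕ
entry T r c with at T r
... | just row = at row c
... | nothing  = nothing

record IsSYT (n : ℕ) (λ′ : List ℕ) (T : List (List ℕ)) : Set where
  field
    shape     : map length T ≡ λ′
    entries   : concat T ↭ applyUpTo suc n
    rowIncr   : ∀ r c x y → entry T r c ≡ just x → entry T r (suc c) ≡ just y → x < y
    colIncr   : ∀ r c x y → entry T r c ≡ just x → entry T (suc r) c ≡ just y → x < y

rowOf : List (List ℕ) → ℕ → ℕ
rowOf []       x = 0
rowOf (r ∷ rs) x = if any (λ y → y ≡ᵇ x) r then 0 else suc (rowOf rs x)

isDescentᵇ : List (List ℕ) → ℕ → Bool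
isDescentᵇ T i = rowOf T i <ᵇ rowOf T (suc i)

maj : ℕ → List (List ℕ) → ℕ
maj n T = sum (map (λ i → if isDescentᵇ T i then i else 0) (applyUpTo suc (n ∸ 1)))

IsMinMaj : ℕ → List ℕ → ℕ → Set
IsMinMaj n λ′ m = Σ (List (List ℕ)) (λ T → IsSYT n λ′ T × maj n T ≡ m)
                × (∀ T → IsSYT n λ′ T → m ≤ maj n T)

IsMaxMaj : ℕ → List ℕ → ℕ → Set
IsMaxMaj n λ′ M = Σ (List (List ℕ)) (λ T → IsSYT n λ′ T × maj n T ≡ M)
                × (∀ T → IsSYT n λ′ T → maj n T ≤ M)

-- A word w₁ … wₙ of row indices determines a tableau: put i at the end of row wᵢ.  When
-- each box goes to a row at least as long as the row below it, the tableau is standard,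
-- and i is a descent exactly when wᵢ < wᵢ₊₁, so maj is read off the word.  It suffices to
-- give two such words of shape λ whose maj differ by 4 (by 6 for rectangles).  Appending
-- the same rows below both tableaux adds the same amount to both maj, so only a few
-- families of shapes matter: two-row prefixes (p, q) with q ≥ 2, where placing the last
-- entry of the first row after the first entry of the second gains p; hooks (p, 1ᵇ),
-- where filling the first row before the first column gains b(p − 1); and six small
-- shapes, checked by computation.
module Submission where

open import Defs
open import Data.Nat.Base
open import Data.Nat.Properties
open import Data.Nat.ListAction using (sum)
open import Data.Nat.ListAction.Properties using (sum-++)
open import Data.Nat.Tactic.RingSolver using (solve-∀)
open import Data.Bool.Base using (true; false; if_then_else_) renaming (T to IsTrue)
open import Data.Bool.Properties using (if-eta)
open import Data.Bool.ListAction using (any)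
open import Data.List.Base using (List; []; _∷_; _++_; _∷ʳ_; map; concat; applyUpTo; length; replicate)
import Data.List.Properties as List
open import Data.List.Membership.Propositional using (_∈_; _∉_)
open import Data.List.Membership.Propositional.Properties using (∈-++⁺ˡ; ∈-++⁺ʳ; ∈-++⁻; ∈-applyUpTo⁺; ∈-applyUpTo⁻)
open import Data.List.Membership.DecPropositional _≟_ using (_∈?_)
open import Data.List.Relation.Unary.All using (All; []; _∷_)
import Data.List.Relation.Unary.All as All
open import Data.List.Relation.Unary.All.Properties using (replicate⁺; drop⁺)
open import Data.List.Relation.Unary.Any using (here; there)
import Data.List.Relation.Unary.Any as Any
open import Data.List.Relation.Unary.Any.Properties using (any⁺; any⁻)
open import Data.List.Relation.Binary.Permutation.Propositional using (_↭_; ↭-refl; ↭-sym; ↭-trans; ↭-reflexive)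
open import Data.List.Relation.Binary.Permutation.Propositional.Properties using (++⁺ˡ; ++⁺ʳ; ∷↭∷ʳ; ∈-resp-↭)
open import Data.Maybe.Base using (just)
open import Data.Product.Base using (∃-syntax; _×_; _,_; proj₁; proj₂)
import Data.Product.Base as Product
open import Data.Sum.Base using (_⊎_; inj₁; inj₂; [_,_]′)
import Data.Sum.Base as Sum
open import Data.Empty using (⊥-elim)
open import Data.Unit.Base using (⊤; tt)
open import Function.Base using (_∘_; id)
open import Relation.Nullary using (Dec; yes; no; contradiction)
open import Relation.Nullary.Decidable using (True; toWitness; _×-dec_)
open import Relation.Binary.PropositionalEquality
open import Algebra.Properties.CommutativeSemigroup +-commutativeSemigroup using (interchange; xy∙z≈xz∙y)

-- Building a standard tableau one box at a time

Tableau : Set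
Tableau = List (List ℕ)

shape : Tableau → List ℕ
shape = map length

part : List ℕ → ℕ → ℕ
part []      r       = 0
part (a ∷ S) zero    = a
part (a ∷ S) (suc r) = part S r

rowAt : Tableau → ℕ → List ℕ
rowAt []        r       = []
rowAt (row ∷ T) zero    = row
rowAt (row ∷ T) (suc r) = rowAt T r

place : ℕ → ℕ → Tableau → Tableau
place zero    x []        = (x ∷ []) ∷ []
place zero    x (row ∷ T) = (row ∷ʳ x) ∷ T
place (suc r) x []        = []
place (suc r) x (row ∷ T) = row ∷ place r x T

addBox : ℕ → List ℕ → List ℕ
addBox zero    []      = 1 ∷ []
addBox zero    (a ∷ S) = suc a ∷ S
addBox (suc r) []      = []
addBox (suc r) (a ∷ S) = a ∷ addBox r S

length-∷ʳ : ∀ (xs : List ℕ) x → length (xs ∷ʳ x) ≡ suc (length xs)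
length-∷ʳ xs x = trans (List.length-++ xs) (+-comm (length xs) 1)

shape-place : ∀ r x T → shape (place r x T) ≡ addBox r (shape T)
shape-place zero    x []        = refl
shape-place zero    x (row ∷ T) = cong (_∷ shape T) (length-∷ʳ row x)
shape-place (suc r) x []        = refl
shape-place (suc r) x (row ∷ T) = cong (length row ∷_) (shape-place r x T)

length-rowAt : ∀ T r → length (rowAt T r) ≡ part (shape T) r
length-rowAt []        r       = refl
length-rowAt (row ∷ T) zero    = refl
length-rowAt (row ∷ T) (suc r) = length-rowAt T r

entry-rowAt : ∀ T r c → entry T r c ≡ at (rowAt T r) c
entry-rowAt []        zero    c = refl
entry-rowAt []        (suc r) c = refl
entry-rowAt (row ∷ T) zero    c = refl
entry-rowAt (row ∷ T) (suc r) c = entry-rowAt T r c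

at-< : ∀ (xs : List ℕ) c {y} → at xs c ≡ just y → c < length xs
at-< (x ∷ xs) zero    _ = s≤s z≤n
at-< (x ∷ xs) (suc c) e = s≤s (at-< xs c e)

at-∈ : ∀ (xs : List ℕ) c {y} → at xs c ≡ just y → y ∈ xs
at-∈ (x ∷ xs) zero    refl = here refl
at-∈ (x ∷ xs) (suc c) e    = there (at-∈ xs c e)

at-∷ʳ : ∀ (xs : List ℕ) x c {y} → at (xs ∷ʳ x) c ≡ just y → at xs c ≡ just y ⊎ (c ≡ length xs × y ≡ x)
at-∷ʳ []       x zero    refl = inj₂ (refl , refl)
at-∷ʳ (z ∷ xs) x zero    e    = inj₁ e
at-∷ʳ (z ∷ xs) x (suc c) e    = Sum.map₂ (Product.map₁ (cong suc)) (at-∷ʳ xs x c e)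

at-rowAt-place : ∀ r x T r′ c {y} → at (rowAt (place r x T) r′) c ≡ just y →
                 at (rowAt T r′) c ≡ just y ⊎ (r′ ≡ r × c ≡ length (rowAt T r) × y ≡ x)
at-rowAt-place zero    x []        zero     c e = Sum.map₂ (refl ,_) (at-∷ʳ [] x c e)
at-rowAt-place zero    x []        (suc r′) c e = inj₁ e
at-rowAt-place zero    x (row ∷ T) zero     c e = Sum.map₂ (refl ,_) (at-∷ʳ row x c e)
at-rowAt-place zero    x (row ∷ T) (suc r′) c e = inj₁ e
at-rowAt-place (suc r) x []        r′       c e = inj₁ e
at-rowAt-place (suc r) x (row ∷ T) zero     c e = inj₁ e
at-rowAt-place (suc r) x (row ∷ T) (suc r′) c e =
  Sum.map₂ (Product.map₁ (cong suc)) (at-rowAt-place r x T r′ c e)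

rowAt-⊆ : ∀ T r {y} → y ∈ rowAt T r → y ∈ concat T
rowAt-⊆ (row ∷ T) zero    y∈ = ∈-++⁺ˡ y∈
rowAt-⊆ (row ∷ T) (suc r) y∈ = ∈-++⁺ʳ row (rowAt-⊆ T r y∈)

concat-place : ∀ r x T → r ≤ length T → concat (place r x T) ↭ concat T ∷ʳ x
concat-place zero    x []        _ = ↭-refl
concat-place zero    x (row ∷ T) _ =
  ↭-trans (↭-reflexive (List.++-assoc row (x ∷ []) (concat T)))
  (↭-trans (++⁺ˡ row (∷↭∷ʳ x (concat T)))
  (↭-reflexive (sym (List.++-assoc row (concat T) (x ∷ [])))))
concat-place (suc r) x (row ∷ T) (s≤s r≤) =
  ↭-trans (++⁺ˡ row (concat-place r x T r≤)) (↭-reflexive (sym (List.++-assoc row (concat T) (x ∷ []))))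

rowOf-here : ∀ {x} row T → x ∈ row → rowOf (row ∷ T) x ≡ 0
rowOf-here {x} row T x∈row
  with any (_≡ᵇ x) row | any⁺ (_≡ᵇ x) (Any.map (λ { refl → ≡⇒≡ᵇ x x refl }) x∈row)
... | true | _ = refl

rowOf-there : ∀ {x} row T → x ∉ row → rowOf (row ∷ T) x ≡ suc (rowOf T x)
rowOf-there {x} row T x∉row with any (_≡ᵇ x) row in eq
... | false = refl
... | true  = ⊥-elim (x∉row (Any.map (λ {y} y≡x → sym (≡ᵇ⇒≡ y x y≡x))
                                     (any⁻ (_≡ᵇ x) row (subst IsTrue (sym eq) tt))))

rowOf-place-old : ∀ r x T {y} → y ≢ x → y ∈ concat T → rowOf (place r x T) y ≡ rowOf T y
rowOf-place-old zero x (row ∷ T) {y} y≢x y∈ with y ∈? row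
... | yes y∈row = trans (rowOf-here (row ∷ʳ x) T (∈-++⁺ˡ y∈row)) (sym (rowOf-here row T y∈row))
... | no  y∉row = trans (rowOf-there (row ∷ʳ x) T y∉row∷ʳx) (sym (rowOf-there row T y∉row))
  where
  y∉row∷ʳx : y ∉ row ∷ʳ x
  y∉row∷ʳx y∈′ = [ y∉row , (λ { (here y≡x) → y≢x y≡x }) ]′ (∈-++⁻ row y∈′)
rowOf-place-old (suc r) x (row ∷ T) {y} y≢x y∈ with y ∈? row
... | yes y∈row = trans (rowOf-here row (place r x T) y∈row) (sym (rowOf-here row T y∈row))
... | no  y∉row =
  trans (rowOf-there row (place r x T) y∉row)
  (trans (cong suc (rowOf-place-old r x T y≢x ([ ⊥-elim ∘ y∉row , id ]′ (∈-++⁻ row y∈))))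
         (sym (rowOf-there row T y∉row)))

rowOf-place-new : ∀ r x T → x ∉ concat T → r ≤ length T → rowOf (place r x T) x ≡ r
rowOf-place-new zero    x []        _  _         = rowOf-here (x ∷ []) [] (here refl)
rowOf-place-new zero    x (row ∷ T) _  _         = rowOf-here (row ∷ʳ x) T (∈-++⁺ʳ row (here refl))
rowOf-place-new (suc r) x (row ∷ T) x∉ (s≤s r≤) =
  trans (rowOf-there row (place r x T) (x∉ ∘ ∈-++⁺ˡ)) (cong suc (rowOf-place-new r x T (x∉ ∘ ∈-++⁺ʳ row) r≤))

Standard : ℕ → Tableau → Set
Standard n T = IsSYT n (shape T) T

standard-[] : Standard 0 []
standard-[] = record
  { shape = refl ; entries = ↭-refl ; rowIncr = λ _ _ _ _ () ; colIncr = λ _ _ _ _ () }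

∈⇒≤size : ∀ {n T y} → Standard n T → y ∈ concat T → y ≤ n
∈⇒≤size s y∈ with ∈-applyUpTo⁻ suc (∈-resp-↭ (IsSYT.entries s) y∈)
... | _ , i<n , refl = i<n

≤size⇒∈ : ∀ {n T y} → Standard n T → 1 ≤ y → y ≤ n → y ∈ concat T
≤size⇒∈ {y = suc i} s _ y≤n = ∈-resp-↭ (↭-sym (IsSYT.entries s)) (∈-applyUpTo⁺ suc y≤n)

-- The next box may go to row r when the cell below it is empty; shapes need not stay
-- partitions, since IsSYT only compares cells that exist.
Addable : List ℕ → ℕ → Set
Addable S r = r ≤ length S × part S (suc r) ≤ part S r

standard-place : ∀ {m T r} → Standard m T → Addable (shape T) r → Standard (suc m) (place r (suc m) T)
standard-place {m} {T} {r} s (r≤ , below≤) = record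
  { shape   = refl
  ; entries = ↭-trans (concat-place r (suc m) T (subst (r ≤_) (List.length-map length T) r≤))
              (↭-trans (++⁺ʳ _ (IsSYT.entries s)) (↭-reflexive (List.applyUpTo-∷ʳ suc m)))
  ; rowIncr = rowIncr
  ; colIncr = colIncr
  }
  where
  T′ = place r (suc m) T

  old-or-new : ∀ r′ c {y} → entry T′ r′ c ≡ just y →
               entry T r′ c ≡ just y ⊎ (r′ ≡ r × c ≡ length (rowAt T r) × y ≡ suc m)
  old-or-new r′ c e = Sum.map₁ (trans (entry-rowAt T r′ c))
    (at-rowAt-place r (suc m) T r′ c (trans (sym (entry-rowAt T′ r′ c)) e))

  old-at : ∀ {r′ c y} → entry T r′ c ≡ just y → at (rowAt T r′) c ≡ just y
  old-at {r′} {c} e = trans (sym (entry-rowAt T r′ c)) e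

  old-cell : ∀ {r′ c y} → entry T r′ c ≡ just y → c < length (rowAt T r′)
  old-cell {r′} {c} e = at-< (rowAt T r′) c (old-at e)

  old<new : ∀ {r′ c y} → entry T r′ c ≡ just y → y < suc m
  old<new {r′} {c} e = s≤s (∈⇒≤size s (rowAt-⊆ T r′ (at-∈ (rowAt T r′) c (old-at e))))

  below-shorter : length (rowAt T (suc r)) ≤ length (rowAt T r)
  below-shorter = subst₂ _≤_ (sym (length-rowAt T (suc r))) (sym (length-rowAt T r)) below≤

  rowIncr : ∀ r′ c x y → entry T′ r′ c ≡ just x → entry T′ r′ (suc c) ≡ just y → x < y
  rowIncr r′ c x y ex ey with old-or-new r′ c ex | old-or-new r′ (suc c) ey
  ... | inj₁ ex′              | inj₁ ey′              = IsSYT.rowIncr s r′ c x y ex′ ey′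
  ... | inj₁ ex′              | inj₂ (_ , _ , refl)   = old<new ex′
  ... | inj₂ (refl , refl , _) | inj₁ ey′             = ⊥-elim (1+n≰n (<⇒≤ (old-cell ey′)))
  ... | inj₂ (_ , c≡ , _)     | inj₂ (_ , 1+c≡ , _)   = ⊥-elim (1+n≰n (≤-reflexive (trans 1+c≡ (sym c≡))))

  colIncr : ∀ r′ c x y → entry T′ r′ c ≡ just x → entry T′ (suc r′) c ≡ just y → x < y
  colIncr r′ c x y ex ey with old-or-new r′ c ex | old-or-new (suc r′) c ey
  ... | inj₁ ex′              | inj₁ ey′              = IsSYT.colIncr s r′ c x y ex′ ey′
  ... | inj₁ ex′              | inj₂ (_ , _ , refl)   = old<new ex′
  ... | inj₂ (refl , refl , _) | inj₁ ey′             =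
    ⊥-elim (<-irrefl refl (<-≤-trans (old-cell ey′) below-shorter))
  ... | inj₂ (r′≡ , _)        | inj₂ (1+r′≡ , _)      = ⊥-elim (1+n≰n (≤-reflexive (trans 1+r′≡ (sym r′≡))))

rowOf-place-size : ∀ {m T r} → Standard m T → Addable (shape T) r → rowOf (place r (suc m) T) (suc m) ≡ r
rowOf-place-size {m} {T} {r} s (r≤ , _) =
  rowOf-place-new r (suc m) T (λ m+1∈ → 1+n≰n (∈⇒≤size s m+1∈)) (subst (r ≤_) (List.length-map length T) r≤)

majTerm : Tableau → ℕ → ℕ
majTerm T i = if isDescentᵇ T i then i else 0

maj-suc : ∀ n T → maj (suc n) T ≡ maj n T + majTerm T n
maj-suc zero    T = sym (if-eta (isDescentᵇ T 0))
maj-suc (suc k) T = begin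
  sum (map (majTerm T) (applyUpTo suc (suc k)))
    ≡⟨ cong (sum ∘ map (majTerm T)) (sym (List.applyUpTo-∷ʳ suc k)) ⟩
  sum (map (majTerm T) (applyUpTo suc k ∷ʳ suc k))
    ≡⟨ cong sum (List.map-++ (majTerm T) (applyUpTo suc k) (suc k ∷ [])) ⟩
  sum (map (majTerm T) (applyUpTo suc k) ∷ʳ majTerm T (suc k))
    ≡⟨ sum-++ (map (majTerm T) (applyUpTo suc k)) (majTerm T (suc k) ∷ []) ⟩
  maj (suc k) T + (majTerm T (suc k) + 0)
    ≡⟨ cong (maj (suc k) T +_) (+-identityʳ _) ⟩
  maj (suc k) T + majTerm T (suc k) ∎
  where open ≡-Reasoning

maj-cong : ∀ n {T U} → (∀ i → 1 ≤ i → i ≤ n → rowOf T i ≡ rowOf U i) → maj n T ≡ maj n U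
maj-cong zero                _ = refl
maj-cong (suc zero)          _ = refl
maj-cong (suc (suc k)) {T} {U} same = begin
  maj (suc (suc k)) T                  ≡⟨ maj-suc (suc k) T ⟩
  maj (suc k) T + majTerm T (suc k)
    ≡⟨ cong₂ _+_ (maj-cong (suc k) {T} {U} (λ i 1≤i i≤ → same i 1≤i (m≤n⇒m≤1+n i≤)))
                 (cong₂ (λ ρ ρ′ → if ρ <ᵇ ρ′ then suc k else 0) (same (suc k) (s≤s z≤n) (n≤1+n _))
                                                                 (same (suc (suc k)) (s≤s z≤n) ≤-refl)) ⟩
  maj (suc k) U + majTerm U (suc k)    ≡⟨ maj-suc (suc k) U ⟨
  maj (suc (suc k)) U                  ∎
  where open ≡-Reasoning

maj-place : ∀ {m T r} → Standard m T → Addable (shape T) r →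
            maj (suc m) (place r (suc m) T) ≡ maj m T + (if rowOf T m <ᵇ r then m else 0)
maj-place {zero}        s _         = sym (if-eta _)
maj-place {suc k} {T} {r} s a = begin
  maj (suc m) T′            ≡⟨ maj-suc m T′ ⟩
  maj m T′ + majTerm T′ m
    ≡⟨ cong₂ _+_ (maj-cong m {T′} {T} (λ i 1≤i i≤m → old-row i≤m (≤size⇒∈ s 1≤i i≤m)))
                 (cong₂ (λ ρ ρ′ → if ρ <ᵇ ρ′ then m else 0) (old-row ≤-refl (≤size⇒∈ s (s≤s z≤n) ≤-refl))
                                                             (rowOf-place-size s a)) ⟩
  maj m T + (if rowOf T m <ᵇ r then m else 0) ∎
  where
  open ≡-Reasoning
  m  = suc k
  T′ = place r (suc m) T

  old-row : ∀ {i} → i ≤ m → i ∈ concat T → rowOf T′ i ≡ rowOf T i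
  old-row i≤m = rowOf-place-old r (suc m) T (λ i≡ → 1+n≰n (subst (_≤ m) i≡ i≤m))

-- Words of rows

grow : List ℕ → List ℕ → List ℕ
grow S []      = S
grow S (r ∷ w) = grow (addBox r S) w

Admissible : List ℕ → List ℕ → Set
Admissible S []      = ⊤
Admissible S (r ∷ w) = Addable S r × Admissible (addBox r S) w

admissible? : ∀ S w → Dec (Admissible S w)
admissible? S []      = yes tt
admissible? S (r ∷ w) = ((r ≤? length S) ×-dec (part S (suc r) ≤? part S r)) ×-dec admissible? (addBox r S) w

placeWord : List ℕ → ℕ → Tableau → Tableau
placeWord []      m T = T
placeWord (r ∷ w) m T = placeWord w (suc m) (place r (suc m) T)

tableau : List ℕ → Tableau
tableau w = placeWord w 0 []

-- majAfter m ρ w sums the descents among m, m + 1, … created by placing m + 1, m + 2, …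
-- in the rows listed by w, when m lies in row ρ.  In wordMaj, ρ = 0 is a dummy: the only
-- term it affects is m = 0.
majAfter : ℕ → ℕ → List ℕ → ℕ
majAfter m ρ []      = 0
majAfter m ρ (r ∷ w) = (if ρ <ᵇ r then m else 0) + majAfter (suc m) r w

wordMaj : List ℕ → ℕ
wordMaj = majAfter 0 0

shape-placeWord : ∀ w m T → shape (placeWord w m T) ≡ grow (shape T) w
shape-placeWord []      m T = refl
shape-placeWord (r ∷ w) m T =
  trans (shape-placeWord w (suc m) (place r (suc m) T)) (cong (λ S → grow S w) (shape-place r (suc m) T))

admissible-place : ∀ {r x} T w → Admissible (addBox r (shape T)) w → Admissible (shape (place r x T)) w
admissible-place {r} {x} T w = subst (λ S → Admissible S w) (sym (shape-place r x T))

standard-placeWord : ∀ w {m T} → Standard m T → Admissible (shape T) w →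
                     Standard (length w + m) (placeWord w m T)
standard-placeWord []      s _         = s
standard-placeWord (r ∷ w) {m} {T} s (a , adm) =
  subst (λ n → Standard n (placeWord w (suc m) (place r (suc m) T))) (+-suc (length w) m)
        (standard-placeWord w (standard-place s a) (admissible-place T w adm))

maj-placeWord : ∀ w {m T} → Standard m T → Admissible (shape T) w →
                maj (length w + m) (placeWord w m T) ≡ maj m T + majAfter m (rowOf T m) w
maj-placeWord []      {m} {T} _ _         = sym (+-identityʳ (maj m T))
maj-placeWord (r ∷ w) {m} {T} s (a , adm) = begin
  maj (suc (length w + m)) (placeWord w (suc m) T′)
    ≡⟨ cong (λ n → maj n (placeWord w (suc m) T′)) (+-suc (length w) m) ⟨
  maj (length w + suc m) (placeWord w (suc m) T′)
    ≡⟨ maj-placeWord w (standard-place s a) (admissible-place T w adm) ⟩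
  maj (suc m) T′ + majAfter (suc m) (rowOf T′ (suc m)) w
    ≡⟨ cong₂ _+_ (maj-place s a)
                 (cong (λ ρ → majAfter (suc m) ρ w) (rowOf-place-size s a)) ⟩
  (maj m T + (if rowOf T m <ᵇ r then m else 0)) + majAfter (suc m) r w
    ≡⟨ +-assoc (maj m T) _ _ ⟩
  maj m T + majAfter m (rowOf T m) (r ∷ w) ∎
  where
  open ≡-Reasoning
  T′ = place r (suc m) T

tableau-SYT : ∀ w → Admissible [] w → IsSYT (length w) (grow [] w) (tableau w)
tableau-SYT w adm = subst₂ (λ n S → IsSYT n S (tableau w)) (+-identityʳ (length w)) (shape-placeWord w 0 [])
                           (standard-placeWord w standard-[] adm)

maj-tableau : ∀ w → Admissible [] w → maj (length w) (tableau w) ≡ wordMaj w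
maj-tableau w adm = trans (cong (λ n → maj n (tableau w)) (sym (+-identityʳ (length w))))
                          (maj-placeWord w standard-[] adm)

lastRow : ℕ → List ℕ → ℕ
lastRow ρ []      = ρ
lastRow ρ (r ∷ w) = lastRow r w

grow-++ : ∀ S w v → grow S (w ++ v) ≡ grow (grow S w) v
grow-++ S []      v = refl
grow-++ S (r ∷ w) v = grow-++ (addBox r S) w v

admissible-++ : ∀ S w v → Admissible S w → Admissible (grow S w) v → Admissible S (w ++ v)
admissible-++ S []      v _         adm′ = adm′
admissible-++ S (r ∷ w) v (a , adm) adm′ = a , admissible-++ (addBox r S) w v adm adm′

majAfter-++ : ∀ m ρ w v → majAfter m ρ (w ++ v) ≡ majAfter m ρ w + majAfter (length w + m) (lastRow ρ w) v
majAfter-++ m ρ []      v = refl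
majAfter-++ m ρ (r ∷ w) v = begin
  c + majAfter (suc m) r (w ++ v)
    ≡⟨ cong (c +_) (majAfter-++ (suc m) r w v) ⟩
  c + (majAfter (suc m) r w + majAfter (length w + suc m) (lastRow r w) v)
    ≡⟨ +-assoc c _ _ ⟨
  c + majAfter (suc m) r w + majAfter (length w + suc m) (lastRow r w) v
    ≡⟨ cong (λ k → c + majAfter (suc m) r w + majAfter k (lastRow r w) v) (+-suc (length w) m) ⟩
  c + majAfter (suc m) r w + majAfter (suc (length w + m)) (lastRow r w) v ∎
  where
  open ≡-Reasoning
  c = if ρ <ᵇ r then m else 0

if-<ᵇ : ∀ {ρ r} m → ρ < r → (if ρ <ᵇ r then m else 0) ≡ m
if-<ᵇ {ρ} {r} m ρ<r with ρ <ᵇ r | <⇒<ᵇ ρ<r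
... | true | _ = refl

if-≥ᵇ : ∀ {ρ r} m → r ≤ ρ → (if ρ <ᵇ r then m else 0) ≡ 0
if-≥ᵇ {ρ} {r} m r≤ρ with ρ <ᵇ r | <ᵇ⇒< ρ r
... | false | _    = refl
... | true  | ρ<r = ⊥-elim (<⇒≱ (ρ<r tt) r≤ρ)

majAfter-replicate : ∀ {r ρ} m k → r ≤ ρ → majAfter m ρ (replicate k r) ≡ 0
majAfter-replicate m zero    r≤ρ = refl
majAfter-replicate {r} m (suc k) r≤ρ = cong₂ _+_ (if-≥ᵇ m r≤ρ) (majAfter-replicate (suc m) k (≤-refl {r}))

majAfter-replicate-++ : ∀ m ρ k r v →
  majAfter m ρ (replicate (suc k) r ++ v) ≡ (if ρ <ᵇ r then m else 0) + majAfter (suc k + m) r v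
majAfter-replicate-++ m ρ zero    r v = refl
majAfter-replicate-++ m ρ (suc k) r v =
  cong ((if ρ <ᵇ r then m else 0) +_)
       (trans (majAfter-replicate-++ (suc m) r k r v)
              (cong₂ _+_ (if-≥ᵇ {r} (suc m) ≤-refl) (cong (λ n → majAfter n r v) (+-suc (suc k) m))))

<-length-addBox : ∀ {r} S → r ≤ length S → r < length (addBox r S)
<-length-addBox {zero}  []      _         = s≤s z≤n
<-length-addBox {zero}  (a ∷ S) _         = s≤s z≤n
<-length-addBox {suc r} (a ∷ S) (s≤s r≤) = s≤s (<-length-addBox S r≤)

lastRow-< : ∀ S w {ρ} → Admissible S w → ρ < length S → lastRow ρ w < length (grow S w)
lastRow-< S []      _              ρ<  = ρ<
lastRow-< S (r ∷ w) ((r≤ , _) , adm) _ = lastRow-< (addBox r S) w adm (<-length-addBox S r≤)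

sum-addBox : ∀ {r} S → r ≤ length S → sum (addBox r S) ≡ suc (sum S)
sum-addBox {zero}  []      _         = refl
sum-addBox {zero}  (a ∷ S) _         = refl
sum-addBox {suc r} (a ∷ S) (s≤s r≤) = trans (cong (a +_) (sum-addBox S r≤)) (+-suc a (sum S))

sum-grow : ∀ S w → Admissible S w → sum (grow S w) ≡ length w + sum S
sum-grow S []      _                = refl
sum-grow S (r ∷ w) ((r≤ , _) , adm) =
  trans (sum-grow (addBox r S) w adm)
        (trans (cong (length w +_) (sum-addBox S r≤)) (+-suc (length w) (sum S)))

addable-new : ∀ S → Addable S (length S)
addable-new []      = z≤n , z≤n
addable-new (a ∷ S) = Product.map₁ s≤s (addable-new S)

addable-last : ∀ S a → Addable (S ∷ʳ a) (length S)
addable-last []      a = z≤n , z≤n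
addable-last (b ∷ S) a = Product.map₁ s≤s (addable-last S a)

addBox-new : ∀ S → addBox (length S) S ≡ S ∷ʳ 1
addBox-new []      = refl
addBox-new (a ∷ S) = cong (a ∷_) (addBox-new S)

addBox-last : ∀ S a → addBox (length S) (S ∷ʳ a) ≡ S ∷ʳ suc a
addBox-last []      a = refl
addBox-last (b ∷ S) a = cong (b ∷_) (addBox-last S a)

admissible-lastRow : ∀ S a k → Admissible (S ∷ʳ a) (replicate k (length S))
admissible-lastRow S a zero    = tt
admissible-lastRow S a (suc k) =
  addable-last S a , subst (λ S′ → Admissible S′ (replicate k (length S))) (sym (addBox-last S a))
                           (admissible-lastRow S (suc a) k)

grow-lastRow : ∀ S a k → grow (S ∷ʳ a) (replicate k (length S)) ≡ S ∷ʳ (a + k)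
grow-lastRow S a zero    = cong (S ∷ʳ_) (sym (+-identityʳ a))
grow-lastRow S a (suc k) =
  trans (cong (λ S′ → grow S′ (replicate k (length S))) (addBox-last S a))
        (trans (grow-lastRow S (suc a) k) (cong (S ∷ʳ_) (sym (+-suc a k))))

admissible-newRow : ∀ S k → Admissible S (replicate k (length S))
admissible-newRow S zero    = tt
admissible-newRow S (suc k) =
  addable-new S , subst (λ S′ → Admissible S′ (replicate k (length S))) (sym (addBox-new S))
                        (admissible-lastRow S 1 k)

grow-newRow : ∀ S k → grow S (replicate (suc k) (length S)) ≡ S ∷ʳ suc k
grow-newRow S k = trans (cong (λ S′ → grow S′ (replicate k (length S))) (addBox-new S)) (grow-lastRow S 1 k)

admissible-firstRow : ∀ a S k → part S 0 ≤ a → Admissible (a ∷ S) (replicate k 0)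
admissible-firstRow a S zero    _   = tt
admissible-firstRow a S (suc k) S≤a = (z≤n , S≤a) , admissible-firstRow (suc a) S k (m≤n⇒m≤1+n S≤a)

grow-firstRow : ∀ a S k → grow (a ∷ S) (replicate k 0) ≡ (a + k) ∷ S
grow-firstRow a S zero    = cong (_∷ S) (sym (+-identityʳ a))
grow-firstRow a S (suc k) = trans (grow-firstRow (suc a) S k) (cong (_∷ S) (sym (+-suc a k)))

rowsWord : ℕ → List ℕ → List ℕ
rowsWord ℓ []       = []
rowsWord ℓ (a ∷ ρs) = replicate a ℓ ++ rowsWord (suc ℓ) ρs

rowsMaj : ℕ → List ℕ → ℕ
rowsMaj m []       = 0
rowsMaj m (a ∷ ρs) = m + rowsMaj (a + m) ρs

admissible-rows : ∀ S ρs → All (1 ≤_) ρs → Admissible S (rowsWord (length S) ρs)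
admissible-rows S []           []       = tt
admissible-rows S (zero  ∷ ρs) (() ∷ _)
admissible-rows S (suc a ∷ ρs) (_ ∷ ps) =
  admissible-++ S (replicate (suc a) (length S)) _ (admissible-newRow S (suc a))
    (subst (λ S′ → Admissible S′ (rowsWord (suc (length S)) ρs)) (sym (grow-newRow S a))
      (subst (λ ℓ → Admissible (S ∷ʳ suc a) (rowsWord ℓ ρs)) (length-∷ʳ S (suc a))
        (admissible-rows (S ∷ʳ suc a) ρs ps)))

grow-rows : ∀ S ρs → All (1 ≤_) ρs → grow S (rowsWord (length S) ρs) ≡ S ++ ρs
grow-rows S []           []       = sym (List.++-identityʳ S)
grow-rows S (zero  ∷ ρs) (() ∷ _)
grow-rows S (suc a ∷ ρs) (_ ∷ ps) = begin
  grow S (replicate (suc a) (length S) ++ rowsWord (suc (length S)) ρs)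
    ≡⟨ grow-++ S (replicate (suc a) (length S)) (rowsWord (suc (length S)) ρs) ⟩
  grow (grow S (replicate (suc a) (length S))) (rowsWord (suc (length S)) ρs)
    ≡⟨ cong (λ S′ → grow S′ (rowsWord (suc (length S)) ρs)) (grow-newRow S a) ⟩
  grow (S ∷ʳ suc a) (rowsWord (suc (length S)) ρs)
    ≡⟨ cong (λ ℓ → grow (S ∷ʳ suc a) (rowsWord ℓ ρs)) (length-∷ʳ S (suc a)) ⟨
  grow (S ∷ʳ suc a) (rowsWord (length (S ∷ʳ suc a)) ρs)
    ≡⟨ grow-rows (S ∷ʳ suc a) ρs ps ⟩
  (S ∷ʳ suc a) ++ ρs
    ≡⟨ List.++-assoc S (suc a ∷ []) ρs ⟩
  S ++ suc a ∷ ρs ∎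
  where open ≡-Reasoning

majAfter-rows : ∀ m {ρ ℓ} ρs → ρ < ℓ → All (1 ≤_) ρs → majAfter m ρ (rowsWord ℓ ρs) ≡ rowsMaj m ρs
majAfter-rows m           []           _   []       = refl
majAfter-rows m           (zero  ∷ ρs) _   (() ∷ _)
majAfter-rows m {ρ} {ℓ} (suc a ∷ ρs) ρ<ℓ (_ ∷ ps) =
  trans (majAfter-replicate-++ m ρ a ℓ _) (cong₂ _+_ (if-<ᵇ m ρ<ℓ) (majAfter-rows (suc a + m) ρs ≤-refl ps))

wordMaj-rows : ∀ ρs → All (1 ≤_) ρs → wordMaj (rowsWord 0 ρs) ≡ rowsMaj 0 ρs
wordMaj-rows []           []       = refl
wordMaj-rows (zero  ∷ ρs) (() ∷ _)
wordMaj-rows (suc a ∷ ρs) (_ ∷ ps) =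
  trans (majAfter-replicate-++ 0 0 a 0 _) (majAfter-rows (suc a + 0) ρs z<s ps)

-- Pairs of fillings far apart in maj

record Fills (ν w : List ℕ) : Set where
  field
    admissible : Admissible [] w
    grows-to   : grow [] w ≡ ν

open Fills

Fills-length : ∀ {ν w} → Fills ν w → length w ≡ sum ν
Fills-length {ν} {w} f =
  trans (sym (+-identityʳ (length w))) (trans (sym (sum-grow [] w (admissible f))) (cong sum (grows-to f)))

Fills⇒SYT : ∀ {ν w} → Fills ν w → IsSYT (length w) ν (tableau w)
Fills⇒SYT {ν} {w} f = subst (λ S → IsSYT (length w) S (tableau w)) (grows-to f) (tableau-SYT w (admissible f))

Fills-++ : ∀ {ν w v} → Fills ν w → Admissible ν v → Fills (grow ν v) (w ++ v)
Fills-++ {ν} {w} {v} f adm = record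
  { admissible = admissible-++ [] w v (admissible f) (subst (λ S → Admissible S v) (sym (grows-to f)) adm)
  ; grows-to   = trans (grow-++ [] w v) (cong (λ S → grow S v) (grows-to f))
  }

Fills-rows : ∀ {ν} → All (1 ≤_) ν → Fills ν (rowsWord 0 ν)
Fills-rows {ν} ps = record { admissible = admissible-rows [] ν ps ; grows-to = grow-rows [] ν ps }

Fills-++rows : ∀ {a ν w ρs} → Fills (a ∷ ν) w → All (1 ≤_) ρs →
               Fills (a ∷ ν ++ ρs) (w ++ rowsWord (length (a ∷ ν)) ρs)
Fills-++rows {a} {ν} {w} {ρs} f ps =
  subst (λ S → Fills S (w ++ rowsWord (length (a ∷ ν)) ρs)) (grow-rows (a ∷ ν) ρs ps)
        (Fills-++ f (admissible-rows (a ∷ ν) ρs ps))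

lastRow-Fills : ∀ {a ν} w → Fills (a ∷ ν) w → lastRow 0 w < length (a ∷ ν)
lastRow-Fills []      f = contradiction (grows-to f) λ ()
lastRow-Fills (r ∷ w) f with admissible f
... | (r≤ , _) , adm = subst (λ S → lastRow r w < length S) (grows-to f)
                             (lastRow-< (addBox r []) w adm (<-length-addBox [] r≤))

wordMaj-++rows : ∀ {a ν w ρs} → Fills (a ∷ ν) w → All (1 ≤_) ρs →
                 wordMaj (w ++ rowsWord (length (a ∷ ν)) ρs) ≡ wordMaj w + rowsMaj (sum (a ∷ ν)) ρs
wordMaj-++rows {a} {ν} {w} {ρs} f ps = begin
  wordMaj (w ++ v)
    ≡⟨ majAfter-++ 0 0 w v ⟩
  wordMaj w + majAfter (length w + 0) (lastRow 0 w) v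
    ≡⟨ cong (wordMaj w +_) (majAfter-rows _ ρs (lastRow-Fills w f) ps) ⟩
  wordMaj w + rowsMaj (length w + 0) ρs
    ≡⟨ cong (λ k → wordMaj w + rowsMaj k ρs) (trans (+-identityʳ _) (Fills-length f)) ⟩
  wordMaj w + rowsMaj (sum (a ∷ ν)) ρs ∎
  where
  open ≡-Reasoning
  v = rowsWord (length (a ∷ ν)) ρs

record MajGap (ν : List ℕ) (d : ℕ) : Set where
  field
    low high   : List ℕ
    low-fills  : Fills ν low
    high-fills : Fills ν high
    gap        : wordMaj low + d ≤ wordMaj high

MajGap-++rows : ∀ {a ν d ρs} → MajGap (a ∷ ν) d → All (1 ≤_) ρs → MajGap (a ∷ ν ++ ρs) d
MajGap-++rows {a} {ν} {d} {ρs} g ps = record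
  { low        = low ++ v
  ; high       = high ++ v
  ; low-fills  = Fills-++rows low-fills ps
  ; high-fills = Fills-++rows high-fills ps
  ; gap        = begin
      wordMaj (low ++ v) + d    ≡⟨ cong (_+ d) (wordMaj-++rows low-fills ps) ⟩
      wordMaj low + X + d       ≡⟨ xy∙z≈xz∙y (wordMaj low) X d ⟩
      wordMaj low + d + X       ≤⟨ +-monoˡ-≤ X gap ⟩
      wordMaj high + X          ≡⟨ wordMaj-++rows high-fills ps ⟨
      wordMaj (high ++ v)       ∎
  }
  where
  open MajGap g
  open ≤-Reasoning
  v = rowsWord (length (a ∷ ν)) ρs
  X = rowsMaj (sum (a ∷ ν)) ρs

majGap-by-computation : ∀ {ν} d low high →
  {True (admissible? [] low)} → {True (admissible? [] high)} → {True (wordMaj low + d ≤? wordMaj high)} →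
  grow [] low ≡ ν → grow [] high ≡ ν → MajGap ν d
majGap-by-computation d low high {low-adm} {high-adm} {low+d≤high} low-grows high-grows = record
  { low        = low
  ; high       = high
  ; low-fills  = record { admissible = toWitness low-adm ; grows-to = low-grows }
  ; high-fills = record { admissible = toWitness high-adm ; grows-to = high-grows }
  ; gap        = toWitness low+d≤high
  }

MajGap⇒spread : ∀ {n ν d m M} → sum ν ≡ n → MajGap ν d → IsMinMaj n ν m → IsMaxMaj n ν M → m + d ≤ M
MajGap⇒spread {n} {ν} {d} {m} {M} sum≡n g (_ , min≤) (_ , ≤max) = begin
  m + d                    ≤⟨ +-monoˡ-≤ d (min≤ (tableau low) (syt low-fills)) ⟩
  maj n (tableau low) + d  ≡⟨ cong (_+ d) (maj-Fills low-fills) ⟩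
  wordMaj low + d          ≤⟨ gap ⟩
  wordMaj high             ≡⟨ maj-Fills high-fills ⟨
  maj n (tableau high)     ≤⟨ ≤max (tableau high) (syt high-fills) ⟩
  M                        ∎
  where
  open MajGap g
  open ≤-Reasoning

  size : ∀ {w} → Fills ν w → length w ≡ n
  size f = trans (Fills-length f) sum≡n

  syt : ∀ {w} → Fills ν w → IsSYT n ν (tableau w)
  syt f = subst (λ k → IsSYT k ν _) (size f) (Fills⇒SYT f)

  maj-Fills : ∀ {w} → Fills ν w → maj n (tableau w) ≡ wordMaj w
  maj-Fills {w} f = trans (cong (λ k → maj k (tableau w)) (sym (size f))) (maj-tableau w (admissible f))

-- The families of shapes

twoRowsGap : ∀ p q → MajGap (2 + p ∷ 2 + q ∷ []) (2 + p)
twoRowsGap p q = record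
  { low        = rowsWord 0 (2 + p ∷ 2 + q ∷ [])
  ; high       = high
  ; low-fills  = Fills-rows (s≤s z≤n ∷ s≤s z≤n ∷ [])
  ; high-fills = subst (λ S → Fills S high) (grow-lastRow (2 + p ∷ []) 1 (suc q))
                       (Fills-++ firstRow rest-admissible)
  ; gap        = ≤-reflexive (trans (cong (_+ (2 + p)) low-maj) (sym high-maj))
  }
  where
  open ≡-Reasoning
  -- Descents p + 1 and p + 3, against the single descent p + 2 of the row-by-row filling.
  rest = 1 ∷ 0 ∷ replicate (suc q) 1
  high = replicate (suc p) 0 ++ rest

  firstRow : Fills (suc p ∷ []) (replicate (suc p) 0)
  firstRow = record { admissible = admissible-newRow [] (suc p) ; grows-to = grow-newRow [] p }

  rest-admissible : Admissible (suc p ∷ []) rest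
  rest-admissible = (s≤s z≤n , z≤n) , (z≤n , s≤s z≤n) , admissible-lastRow (2 + p ∷ []) 1 (suc q)

  low-maj : wordMaj (rowsWord 0 (2 + p ∷ 2 + q ∷ [])) ≡ 2 + p
  low-maj = trans (wordMaj-rows _ (s≤s z≤n ∷ s≤s z≤n ∷ [])) (trans (+-identityʳ _) (+-identityʳ _))

  high-maj : wordMaj high ≡ (2 + p) + (2 + p)
  high-maj = begin
    wordMaj high
      ≡⟨ majAfter-replicate-++ 0 0 p 0 rest ⟩
    suc p + 0 + (3 + p + 0 + majAfter (4 + p + 0) 1 (replicate q 1))
      ≡⟨ cong (λ x → suc p + 0 + (3 + p + 0 + x)) (majAfter-replicate _ q ≤-refl) ⟩
    suc p + 0 + (3 + p + 0 + 0)
      ≡⟨ arithmetic p ⟩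
    (2 + p) + (2 + p) ∎
    where
    arithmetic : ∀ p → suc p + 0 + (3 + p + 0 + 0) ≡ (2 + p) + (2 + p)
    arithmetic = solve-∀

rowsMaj-ones : ∀ b k x → rowsMaj (k + x) (replicate b 1) ≡ b * k + rowsMaj x (replicate b 1)
rowsMaj-ones zero    k x = refl
rowsMaj-ones (suc b) k x = begin
  (k + x) + rowsMaj (suc (k + x)) (replicate b 1)
    ≡⟨ cong (λ y → (k + x) + rowsMaj y (replicate b 1)) (+-suc k x) ⟨
  (k + x) + rowsMaj (k + suc x) (replicate b 1)
    ≡⟨ cong ((k + x) +_) (rowsMaj-ones b k (suc x)) ⟩
  (k + x) + (b * k + rowsMaj (suc x) (replicate b 1))
    ≡⟨ interchange k x (b * k) _ ⟩
  (k + b * k) + (x + rowsMaj (suc x) (replicate b 1)) ∎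
  where open ≡-Reasoning

hookGap : ∀ p b → MajGap (suc p ∷ replicate b 1) (b * p)
hookGap p b = record
  { low        = column ++ replicate p 0
  ; high       = rowsWord 0 (suc p ∷ replicate b 1)
  ; low-fills  = subst (λ S → Fills S (column ++ replicate p 0)) (grow-firstRow 1 (replicate b 1) p)
                       (Fills-++ (Fills-rows (replicate⁺ (suc b) ≤-refl))
                                 (admissible-firstRow 1 (replicate b 1) p (first≤1 b)))
  ; high-fills = Fills-rows (s≤s z≤n ∷ replicate⁺ b ≤-refl)
  ; gap        = ≤-reflexive (trans (cong (_+ b * p) low-maj) (trans (+-comm _ (b * p)) (sym high-maj)))
  }
  where
  open ≡-Reasoning
  column = rowsWord 0 (replicate (suc b) 1)

  first≤1 : ∀ b → part (replicate b 1) 0 ≤ 1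
  first≤1 zero    = z≤n
  first≤1 (suc b) = ≤-refl

  low-maj : wordMaj (column ++ replicate p 0) ≡ rowsMaj 1 (replicate b 1)
  low-maj = begin
    wordMaj (column ++ replicate p 0)
      ≡⟨ majAfter-++ 0 0 column (replicate p 0) ⟩
    wordMaj column + majAfter (length column + 0) (lastRow 0 column) (replicate p 0)
      ≡⟨ cong (wordMaj column +_) (majAfter-replicate _ p z≤n) ⟩
    wordMaj column + 0
      ≡⟨ +-identityʳ _ ⟩
    wordMaj column
      ≡⟨ wordMaj-rows _ (replicate⁺ (suc b) ≤-refl) ⟩
    rowsMaj 1 (replicate b 1) ∎

  high-maj : wordMaj (rowsWord 0 (suc p ∷ replicate b 1)) ≡ b * p + rowsMaj 1 (replicate b 1)
  high-maj = begin
    wordMaj (rowsWord 0 (suc p ∷ replicate b 1))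
      ≡⟨ wordMaj-rows _ (s≤s z≤n ∷ replicate⁺ b ≤-refl) ⟩
    rowsMaj (suc p + 0) (replicate b 1)
      ≡⟨ cong (λ k → rowsMaj k (replicate b 1)) (trans (+-identityʳ (suc p)) (+-comm 1 p)) ⟩
    rowsMaj (p + 1) (replicate b 1)
      ≡⟨ rowsMaj-ones b p 1 ⟩
    b * p + rowsMaj 1 (replicate b 1) ∎

gap-3-2 : MajGap (3 ∷ 2 ∷ []) 4
gap-3-2 = majGap-by-computation 4 (0 ∷ 0 ∷ 1 ∷ 1 ∷ 0 ∷ []) (0 ∷ 0 ∷ 1 ∷ 0 ∷ 1 ∷ []) refl refl

gap-3-3 : MajGap (3 ∷ 3 ∷ []) 6
gap-3-3 = majGap-by-computation 6 (0 ∷ 0 ∷ 0 ∷ 1 ∷ 1 ∷ 1 ∷ []) (0 ∷ 1 ∷ 0 ∷ 1 ∷ 0 ∷ 1 ∷ []) refl refl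

gap-4-4 : MajGap (4 ∷ 4 ∷ []) 6
gap-4-4 = majGap-by-computation 6 (0 ∷ 0 ∷ 0 ∷ 0 ∷ 1 ∷ 1 ∷ 1 ∷ 1 ∷ [])
                                   (0 ∷ 1 ∷ 0 ∷ 1 ∷ 0 ∷ 1 ∷ 0 ∷ 1 ∷ []) refl refl

gap-5-5 : MajGap (5 ∷ 5 ∷ []) 6
gap-5-5 = majGap-by-computation 6 (0 ∷ 0 ∷ 0 ∷ 0 ∷ 0 ∷ 1 ∷ 1 ∷ 1 ∷ 1 ∷ 1 ∷ [])
                                   (0 ∷ 1 ∷ 0 ∷ 1 ∷ 0 ∷ 1 ∷ 0 ∷ 1 ∷ 0 ∷ 1 ∷ []) refl refl

gap-2-2-2 : MajGap (2 ∷ 2 ∷ 2 ∷ []) 6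
gap-2-2-2 = majGap-by-computation 6 (0 ∷ 0 ∷ 1 ∷ 1 ∷ 2 ∷ 2 ∷ []) (0 ∷ 1 ∷ 2 ∷ 0 ∷ 1 ∷ 2 ∷ []) refl refl

gap-2-2-1-1 : MajGap (2 ∷ 2 ∷ 1 ∷ 1 ∷ []) 4
gap-2-2-1-1 = majGap-by-computation 4 (0 ∷ 1 ∷ 2 ∷ 0 ∷ 3 ∷ 1 ∷ []) (0 ∷ 1 ∷ 0 ∷ 1 ∷ 2 ∷ 3 ∷ []) refl refl

WideGap : List ℕ → Set
WideGap λ′ = ∃[ d ] MajGap λ′ d × 4 ≤ d × (∀ a b → λ′ ≡ replicate b a → 6 ≤ d)

replicate-∷ : ∀ {x : ℕ} {xs b a} → x ∷ xs ≡ replicate b a → x ≡ a × xs ≡ replicate (pred b) a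
replicate-∷ {b = suc b} refl = refl , refl

≢⇒not-rectangle : ∀ {x y : ℕ} {zs b a} → x ≢ y → x ∷ y ∷ zs ≢ replicate b a
≢⇒not-rectangle x≢y e with replicate-∷ e
... | refl , e′ = x≢y (sym (proj₁ (replicate-∷ e′)))

largeWideGap : ∀ {a ν ρs d} → MajGap (a ∷ ν) d → 6 ≤ d → All (1 ≤_) ρs → WideGap (a ∷ ν ++ ρs)
largeWideGap g 6≤d ps = _ , MajGap-++rows g ps , ≤-trans (m≤m+n 4 2) 6≤d , λ _ _ _ → 6≤d

unequalWideGap : ∀ {x y ν ρs d} → x ≢ y → MajGap (x ∷ y ∷ ν) d → 4 ≤ d → All (1 ≤_) ρs →
                 WideGap (x ∷ y ∷ ν ++ ρs)
unequalWideGap x≢y g 4≤d ps = _ , MajGap-++rows g ps , 4≤d , λ _ _ → ⊥-elim ∘ ≢⇒not-rectangle x≢y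

all-positive : ∀ xs → (∀ i x → at xs i ≡ just x → 1 ≤ x) → All (1 ≤_) xs
all-positive []       _   = []
all-positive (x ∷ xs) pos = pos 0 x refl ∷ all-positive xs (pos ∘ suc)

all-≤-head : ∀ h xs → (∀ i x y → at (h ∷ xs) i ≡ just x → at (h ∷ xs) (suc i) ≡ just y → y ≤ x) →
             All (_≤ h) xs
all-≤-head h []       _   = []
all-≤-head h (y ∷ ys) dec = y≤h ∷ All.map (λ z≤y → ≤-trans z≤y y≤h) (all-≤-head y ys (dec ∘ suc))
  where y≤h = dec 0 h y refl refl

all-ones : ∀ xs → All (1 ≤_) xs → All (_≤ 1) xs → xs ≡ replicate (sum xs) 1
all-ones []       []           []           = refl
all-ones (x ∷ xs) (1≤x ∷ 1≤xs) (x≤1 ∷ xs≤1) with ≤-antisym x≤1 1≤x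
... | refl = cong (1 ∷_) (all-ones xs 1≤xs xs≤1)

parts-positive : ∀ {n λ′} → IsPartition n λ′ → All (1 ≤_) λ′
parts-positive P = all-positive _ (IsPartition.positive P)

6≤sum : ∀ {n λ′} → IsPartition n λ′ → 6 ≤ n → 6 ≤ sum λ′
6≤sum P = subst (6 ≤_) (sym (IsPartition.sums P))

4≤hook : ∀ p b → 6 ≤ 2 + p + suc b → 4 ≤ suc b * suc p
4≤hook p b 6≤ = ≤-trans (subst (4 ≤_) (+-suc p b) (≤-pred (≤-pred 6≤))) (+-monoʳ-≤ (suc p) (m≤m*n b (suc p)))

hookWideGap : ∀ {n} p rest → IsPartition n (2 + p ∷ 1 ∷ rest) → 6 ≤ n → WideGap (2 + p ∷ 1 ∷ rest)
hookWideGap p rest P 6≤n =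
  suc b * suc p , subst (λ μ → MajGap (2 + p ∷ μ) (suc b * suc p)) (sym ones) (hookGap (suc p) (suc b)) ,
  4≤hook p b (6≤sum P 6≤n) , λ _ _ → ⊥-elim ∘ ≢⇒not-rectangle (λ ())
  where
  b = sum rest
  ones : 1 ∷ rest ≡ replicate (suc b) 1
  ones = all-ones (1 ∷ rest) (drop⁺ 1 (parts-positive P))
                  (≤-refl ∷ all-≤-head 1 rest (IsPartition.decreasing P ∘ suc))

unequalRowsWideGap : ∀ p q rest → q < p → All (1 ≤_) rest → WideGap (2 + p ∷ 2 + q ∷ rest)
unequalRowsWideGap 1             0       rest _         ps = unequalWideGap (λ ()) gap-3-2 ≤-refl ps
unequalRowsWideGap 1             (suc q) rest (s≤s ()) ps
unequalRowsWideGap (suc (suc p)) q       rest q<p      ps =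
  unequalWideGap (λ e → <⇒≢ q<p (sym (suc-injective (suc-injective e)))) (twoRowsGap (2 + p) q) (m≤m+n 4 p) ps

twoByTwoWideGap : ∀ {n} rest → IsPartition n (2 ∷ 2 ∷ rest) → 6 ≤ n → WideGap (2 ∷ 2 ∷ rest)
twoByTwoWideGap []                      P 6≤n = contradiction (6≤sum P 6≤n) λ { (s≤s (s≤s (s≤s (s≤s ())))) }
twoByTwoWideGap (1 ∷ [])                P 6≤n =
  contradiction (6≤sum P 6≤n) λ { (s≤s (s≤s (s≤s (s≤s (s≤s ()))))) }
twoByTwoWideGap (0 ∷ rest)              P _   = contradiction (IsPartition.positive P 2 0 refl) λ ()
twoByTwoWideGap (1 ∷ 0 ∷ rest)          P _   = contradiction (IsPartition.positive P 3 0 refl) λ ()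
twoByTwoWideGap (suc (suc (suc r)) ∷ _) P _   =
  contradiction (IsPartition.decreasing P 1 2 _ refl refl) λ { (s≤s (s≤s ())) }
twoByTwoWideGap (1 ∷ suc (suc r) ∷ _)   P _   =
  contradiction (IsPartition.decreasing P 2 1 _ refl refl) λ { (s≤s ()) }
twoByTwoWideGap (2 ∷ rest)              P _   = largeWideGap gap-2-2-2 ≤-refl (drop⁺ 3 (parts-positive P))
twoByTwoWideGap (1 ∷ 1 ∷ rest)          P _   =
  4 , MajGap-++rows gap-2-2-1-1 (drop⁺ 4 (parts-positive P)) , ≤-refl ,
  λ _ _ → ⊥-elim ∘ ≢⇒not-rectangle (λ ()) ∘ proj₂ ∘ replicate-∷

equalRowsWideGap : ∀ {n} p rest → IsPartition n (2 + p ∷ 2 + p ∷ rest) → 6 ≤ n →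
                   WideGap (2 + p ∷ 2 + p ∷ rest)
equalRowsWideGap 0 rest P 6≤n = twoByTwoWideGap rest P 6≤n
equalRowsWideGap 1 rest P _   = largeWideGap gap-3-3 ≤-refl (drop⁺ 2 (parts-positive P))
equalRowsWideGap 2 rest P _   = largeWideGap gap-4-4 ≤-refl (drop⁺ 2 (parts-positive P))
equalRowsWideGap 3 rest P _   = largeWideGap gap-5-5 ≤-refl (drop⁺ 2 (parts-positive P))
equalRowsWideGap p@(suc (suc (suc (suc k)))) rest P _ =
  largeWideGap (twoRowsGap p p) (m≤m+n 6 k) (drop⁺ 2 (parts-positive P))

partitionWideGap : ∀ n → 6 ≤ n → ∀ λ′ → IsPartition n λ′ → λ′ ≢ replicate n 1 → λ′ ≢ n ∷ [] → WideGap λ′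
partitionWideGap n 6≤n []                P _ _ = contradiction (6≤sum P 6≤n) λ ()
partitionWideGap n _   (p ∷ [])          P _ ≢[n] =
  contradiction (cong (_∷ []) (trans (sym (+-identityʳ p)) (IsPartition.sums P))) ≢[n]
partitionWideGap n _   (0 ∷ q ∷ rest)    P _ _ = contradiction (IsPartition.positive P 0 0 refl) λ ()
partitionWideGap n _   (p ∷ 0 ∷ rest)    P _ _ = contradiction (IsPartition.positive P 1 0 refl) λ ()
partitionWideGap n _   (1 ∷ suc q ∷ rest) P ≢1ⁿ _ =
  contradiction (trans (all-ones _ (parts-positive P) (≤-refl ∷ all-≤-head 1 _ (IsPartition.decreasing P)))
                       (cong (λ k → replicate k 1) (IsPartition.sums P))) ≢1ⁿ
partitionWideGap n 6≤n (suc (suc p) ∷ 1 ∷ rest) P _ _ = hookWideGap p rest P 6≤n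
partitionWideGap n 6≤n (suc (suc p) ∷ suc (suc q) ∷ rest) P _ _
  with m≤n⇒m<n∨m≡n (≤-pred (≤-pred (IsPartition.decreasing P 0 _ _ refl refl)))
... | inj₁ q<p  = unequalRowsWideGap p q rest q<p (drop⁺ 2 (parts-positive P))
... | inj₂ refl = equalRowsWideGap p rest P 6≤n

mainTheorem4 : (n : ℕ) → 6 ≤ n → (λ′ : List ℕ) → IsPartition n λ′
    → λ′ ≢ replicate n 1 → λ′ ≢ n ∷ []
    → (m M : ℕ) → IsMinMaj n λ′ m → IsMaxMaj n λ′ M
    → (m + 4 ≤ M) × ((a b : ℕ) → λ′ ≡ replicate b a → m + 6 ≤ M)
mainTheorem4 n 6≤n λ′ P ≢1ⁿ ≢[n] m M isMin isMax with partitionWideGap n 6≤n λ′ P ≢1ⁿ ≢[n]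
... | d , g , 4≤d , rectangle⇒6≤d =
  ≤-trans (+-monoʳ-≤ m 4≤d) m+d≤M , λ a b e → ≤-trans (+-monoʳ-≤ m (rectangle⇒6≤d a b e)) m+d≤M
  where
  m+d≤M : m + d ≤ M
  m+d≤M = MajGap⇒spread (IsPartition.sums P) g isMin isMax
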